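{- For all $r,m\in\mathbb N$ there exists $n\in\mathbb N$ such that for every coloring of $I^n(1)$ with $r$ colors, $I^n(1)$ contains a monochromatic Euclidean isometric copy of $I^m(2)$.
   Context: For $a>0$ and $j\in\mathbb N$, $I^j(a)$ denotes the vertex set of a $j$-dimensional hypercube of side length $\sqrt a$; $I^n(1)$ can be taken as $\{0,1\}^n\subset\mathbb R^n$. An isometric copy of $A$ inside $I^n(1)$ is a subset of $I^n(1)$ admitting a bijection from $A$ preserving Euclidean distances. Monochromatic means all points have the same color. -}

module Defs where

open import Data.Nat using (ℕ; zero; suc; _+_; _*_)
open import Data.Bool using (Bool; true; false)
open import Data.Fin using (Fin; zero; suc)
open import Data.Product using (Σ; _×_; ∃)
open import Relation.Binary.PropositionalEquality using (_≡_)

-- Vertex set of the unit hypercube I^n(1) = {0,1}^n, points as Fin n → Bool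
-- (false ↦ 0, true ↦ 1).
Cube : ℕ → Set
Cube n = Fin n → Bool

sqDiff : Bool → Bool → ℕ
sqDiff false false = 0
sqDiff true  true  = 0
sqDiff false true  = 1
sqDiff true  false = 1

sqDist : ∀ {n} → Cube n → Cube n → ℕ
sqDist {zero}  x y = 0
sqDist {suc n} x y = sqDiff (x zero) (y zero) + sqDist {n} (λ i → x (suc i)) (λ i → y (suc i))

-- I^m(2) is the cube of side √2, realised as √2·{0,1}^m; its squared Euclidean
-- distances are 2 · sqDist.  An isometric copy of I^m(2) inside I^n(1) is the
-- image of a map e : Cube m → Cube n preserving Euclidean distances, i.e.
-- sqDist (e x) (e y) = 2 * sqDist x y (such an e is automatically injective,
-- hence a bijection onto its image).
IsometricEmbedding₂ : (m n : ℕ) → (Cube m → Cube n) → Set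
IsometricEmbedding₂ m n e = ∀ x y → sqDist (e x) (e y) ≡ 2 * sqDist x y

Monochromatic : ∀ {m n r} → (Cube n → Fin r) → (Cube m → Cube n) → Set
Monochromatic c e = ∀ x y → c (e x) ≡ c (e y)

-- Given an r-colouring c of I^(1+r+n)(1) = I^(1+r)(1) × I^n(1),
-- colour z ∈ I^n(1) by the vector of colours c(u_k, z) of the 1+r unit vectors u_k,
-- which uses r^(1+r) colours; by induction I^n(1) contains a copy E of I^m(2)
-- on which this vector is constant.  By pigeonhole two unit vectors u_i ≠ u_j get
-- the same colour there, and as |u_i − u_j| = √2 the product {u_i, u_j} × E is a
-- monochromatic copy of I^(1+m)(2).
module Submission where

open import Defs
open import Data.Nat using (ℕ; zero; suc; _+_; _*_; _^_)
open import Data.Nat.Properties using (+-assoc; *-distribˡ-+; n<1+n)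
open import Data.Bool using (Bool; true; false)
open import Data.Fin using (Fin; zero; suc; splitAt; funToFin; finToFun)
open import Data.Fin.Properties using (finToFun-funToFin; pigeonhole; <⇒≢)
open import Data.Vec.Functional using ([]; head; tail; _++_; take; drop)
open import Data.Sum.Properties using ([,]-map)
open import Data.Product using (Σ; _×_; _,_)
open import Function using (_∘_; const)
open import Relation.Binary.PropositionalEquality
open import Relation.Nullary using (¬_; contradiction)

private
  variable
    m n m₁ m₂ n₁ n₂ r : ℕ

sqDiff-self : ∀ a → sqDiff a a ≡ 0
sqDiff-self false = refl
sqDiff-self true  = refl

sqDiff-comm : ∀ a b → sqDiff a b ≡ sqDiff b a
sqDiff-comm false false = refl
sqDiff-comm false true  = refl
sqDiff-comm true  false = refl
sqDiff-comm true  true  = refl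

sqDist-cong : {x x′ y y′ : Cube n} → x ≗ x′ → y ≗ y′ → sqDist x y ≡ sqDist x′ y′
sqDist-cong {zero}  x≗x′ y≗y′ = refl
sqDist-cong {suc n} x≗x′ y≗y′ =
  cong₂ _+_ (cong₂ sqDiff (x≗x′ zero) (y≗y′ zero)) (sqDist-cong (x≗x′ ∘ suc) (y≗y′ ∘ suc))

sqDist-self : (x : Cube n) → sqDist x x ≡ 0
sqDist-self {zero}  x = refl
sqDist-self {suc n} x = cong₂ _+_ (sqDiff-self (head x)) (sqDist-self (tail x))

sqDist-comm : (x y : Cube n) → sqDist x y ≡ sqDist y x
sqDist-comm {zero}  x y = refl
sqDist-comm {suc n} x y = cong₂ _+_ (sqDiff-comm (head x) (head y)) (sqDist-comm (tail x) (tail y))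

tail-++ : (x : Cube (suc m)) (y : Cube n) → tail (x ++ y) ≗ tail x ++ y
tail-++ {m} x y i = [,]-map (splitAt m i)

sqDist-++ : (x x′ : Cube m) (y y′ : Cube n) →
            sqDist (x ++ y) (x′ ++ y′) ≡ sqDist x x′ + sqDist y y′
sqDist-++ {zero}  x x′ y y′ = refl
sqDist-++ {suc m} x x′ y y′ = begin
  sqDiff (head x) (head x′) + sqDist (tail (x ++ y)) (tail (x′ ++ y′))
    ≡⟨ cong (sqDiff (head x) (head x′) +_) (sqDist-cong (tail-++ x y) (tail-++ x′ y′)) ⟩
  sqDiff (head x) (head x′) + sqDist (tail x ++ y) (tail x′ ++ y′)
    ≡⟨ cong (sqDiff (head x) (head x′) +_) (sqDist-++ (tail x) (tail x′) y y′) ⟩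
  sqDiff (head x) (head x′) + (sqDist (tail x) (tail x′) + sqDist y y′)
    ≡⟨ +-assoc (sqDiff (head x) (head x′)) _ _ ⟨
  sqDist x x′ + sqDist y y′
    ∎
  where open ≡-Reasoning

sqDist-take-drop : ∀ m {n} (x y : Cube (m + n)) →
                   sqDist x y ≡ sqDist (take m x) (take m y) + sqDist (drop m x) (drop m y)
sqDist-take-drop zero    x y = refl
sqDist-take-drop (suc m) x y =
  trans (cong (sqDiff (head x) (head y) +_) (sqDist-take-drop m (tail x) (tail y)))
        (sym (+-assoc (sqDiff (head x) (head y)) _ _))

isometric-++ : ∀ {f : Cube m₁ → Cube n₁} {g : Cube m₂ → Cube n₂} →
               IsometricEmbedding₂ m₁ n₁ f → IsometricEmbedding₂ m₂ n₂ g →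
               IsometricEmbedding₂ (m₁ + m₂) (n₁ + n₂) (λ x → f (take m₁ x) ++ g (drop m₁ x))
isometric-++ {m₁} {f = f} {g} f-iso g-iso x y = begin
  sqDist (f (take m₁ x) ++ g (drop m₁ x)) (f (take m₁ y) ++ g (drop m₁ y))
    ≡⟨ sqDist-++ (f (take m₁ x)) (f (take m₁ y)) (g (drop m₁ x)) (g (drop m₁ y)) ⟩
  sqDist (f (take m₁ x)) (f (take m₁ y)) + sqDist (g (drop m₁ x)) (g (drop m₁ y))
    ≡⟨ cong₂ _+_ (f-iso (take m₁ x) (take m₁ y)) (g-iso (drop m₁ x) (drop m₁ y)) ⟩
  2 * sqDist (take m₁ x) (take m₁ y) + 2 * sqDist (drop m₁ x) (drop m₁ y)
    ≡⟨ *-distribˡ-+ 2 (sqDist (take m₁ x) (take m₁ y)) _ ⟨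
  2 * (sqDist (take m₁ x) (take m₁ y) + sqDist (drop m₁ x) (drop m₁ y))
    ≡⟨ cong (2 *_) (sqDist-take-drop m₁ x y) ⟨
  2 * sqDist x y
    ∎
  where open ≡-Reasoning

isometric-edge : (p : Bool → Cube n) → sqDist (p false) (p true) ≡ 2 →
                 IsometricEmbedding₂ 1 n (p ∘ head)
isometric-edge p d≡2 x y with head x | head y
... | false | false = sqDist-self (p false)
... | true  | true  = sqDist-self (p true)
... | false | true  = d≡2
... | true  | false = trans (sqDist-comm (p true) (p false)) d≡2

unit : Fin n → Cube n
unit zero    zero    = true
unit zero    (suc k) = false
unit (suc i) zero    = false
unit (suc i) (suc k) = unit i k

sqDist-origin-unit : (i : Fin n) → sqDist (const false) (unit i) ≡ 1
sqDist-origin-unit {suc n} zero    = cong suc (sqDist-self {n} (const false))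
sqDist-origin-unit {suc n} (suc i) = sqDist-origin-unit i

sqDist-unit : {i j : Fin n} → ¬ i ≡ j → sqDist (unit i) (unit j) ≡ 2
sqDist-unit {i = zero}  {zero}  i≢j = contradiction refl i≢j
sqDist-unit {i = zero}  {suc j} i≢j = cong suc (sqDist-origin-unit j)
sqDist-unit {i = suc i} {zero}  i≢j =
  cong suc (trans (sqDist-comm (unit i) (const false)) (sqDist-origin-unit i))
sqDist-unit {i = suc i} {suc j} i≢j = sqDist-unit (i≢j ∘ cong suc)

funToFin-injective : {f g : Fin m → Fin n} → funToFin f ≡ funToFin g → f ≗ g
funToFin-injective {f = f} {g} eq i = begin
  f i                      ≡⟨ finToFun-funToFin f i ⟨
  finToFun (funToFin f) i  ≡⟨ cong (λ k → finToFun k i) eq ⟩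
  finToFun (funToFin g) i  ≡⟨ finToFun-funToFin g i ⟩
  g i                      ∎
  where open ≡-Reasoning

MonochromaticCopies : (r m n : ℕ) → Set
MonochromaticCopies r m n = (c : Cube n → Fin r) →
  Σ (Cube m → Cube n) (λ e → IsometricEmbedding₂ m n e × Monochromatic {m} {n} {r} c e)

monochromaticCopies-zero : MonochromaticCopies r 0 0
monochromaticCopies-zero c = const [] , (λ _ _ → refl) , (λ _ _ → refl)

unitColours : (Cube (suc r + n) → Fin r) → Cube n → Fin (suc r) → Fin r
unitColours c z k = c (unit k ++ z)

monochromaticCopies-suc : MonochromaticCopies (r ^ suc r) m n →
                          MonochromaticCopies r (suc m) (suc r + n)
monochromaticCopies-suc {r} {m} {n} copies c
  with copies (funToFin ∘ unitColours c)
... | e₂ , e₂-iso , e₂-mono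
  with pigeonhole (n<1+n r) (unitColours c (e₂ (const false)))
... | i , j , i<j , same = e , e-iso , e-mono
  where
  colours : Fin (suc r) → Fin r
  colours = unitColours c (e₂ (const false))

  choose : Bool → Fin (suc r)
  choose false = i
  choose true  = j

  colours-choose : ∀ b → colours (choose b) ≡ colours i
  colours-choose false = refl
  colours-choose true  = sym same

  e₁ : Cube 1 → Cube (suc r)
  e₁ = unit ∘ choose ∘ head

  e : Cube (suc m) → Cube (suc r + n)
  e x = e₁ (take 1 x) ++ e₂ (drop 1 x)

  e-iso : IsometricEmbedding₂ (suc m) (suc r + n) e
  e-iso = isometric-++ {f = e₁} {g = e₂}
            (isometric-edge (unit ∘ choose) (sqDist-unit (<⇒≢ i<j))) e₂-iso

  c∘e≡colours-i : ∀ x → c (e x) ≡ colours i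
  c∘e≡colours-i x =
    trans (funToFin-injective {f = unitColours c (e₂ (tail x))} {g = colours}
                              (e₂-mono (tail x) (const false)) (choose (head x)))
          (colours-choose (head x))

  e-mono : Monochromatic {suc m} {suc r + n} {r} c e
  e-mono x y = trans (c∘e≡colours-i x) (sym (c∘e≡colours-i y))

monochromaticCopies : ∀ m r → Σ ℕ (MonochromaticCopies r m)
monochromaticCopies zero    r = 0 , monochromaticCopies-zero
monochromaticCopies (suc m) r =
  let n , copies = monochromaticCopies m (r ^ suc r) in suc r + n , monochromaticCopies-suc copies

proposition3 : (r m : ℕ) → Σ ℕ (λ n → (c : Cube n → Fin r) →
    Σ (Cube m → Cube n) (λ e → IsometricEmbedding₂ m n e × Monochromatic {m} {n} {r} c e))
proposition3 r m = monochromaticCopies m r
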